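{- Let $A=(A(1),\ldots,A(n))$ be a $2$-sorted array of elements of a totally ordered set. If $(i,i+3)$ is a $3$-inversion of $A$, then $(i,i+1)$ and $(i+2,i+3)$ are $1$-inversions of $A$, and $(i+1,i+2)$ is not a $1$-inversion of $A$.
   Context: An array $A$ is $k$-sorted if $A(i)\le A(i+k)$ for all $1\le i\le n-k$. A $p$-inversion of $A$ is a pair $(i,i+p)$ with $1\le i<i+p\le n$ and $A(i)>A(i+p)$. -}

module Defs where

open import Level using (Level)
open import Data.Nat as ℕ using (ℕ; suc; _+_)
open import Data.Fin using (Fin; fromℕ<)
open import Data.Product using (Σ-syntax; _×_)
open import Relation.Binary.Bundles using (TotalOrder)
import Relation.Binary.Construct.NonStrictToStrict as ToStrict

-- Arrays are 1-indexed: A(1), …, A(n).  An array of length n over the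
-- carrier of a total order is a function  Fin n → Carrier;  the Fin
-- index  fromℕ< (i-1)  holds the entry at 1-based position i.
module _ {c ℓ₁ ℓ₂ : Level} (O : TotalOrder c ℓ₁ ℓ₂) where
  open TotalOrder O

  _<ₒ_ : Carrier → Carrier → Set _
  _<ₒ_ = ToStrict._<_ _≈_ _≤_

  -- A(i) for a 1-based position i, given the bound proof  i ≤ n
  -- (i ≥ 1 is encoded by writing i = suc k).
  at : {n : ℕ} → (Fin n → Carrier) → (k : ℕ) → suc k ℕ.≤ n → Carrier
  at A k sk≤n = A (fromℕ< sk≤n)

  Sorted : (k n : ℕ) → (Fin n → Carrier) → Set _
  Sorted k n A = ∀ (j : ℕ) (i≤n : suc j ℕ.≤ n) (ik≤n : suc j + k ℕ.≤ n) →
                 at A j i≤n ≤ at A (j + k) ik≤n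

  Inversion : (p n : ℕ) → (Fin n → Carrier) → (j : ℕ) → Set _
  Inversion p n A j =
    (0 ℕ.< p) × Σ[ i≤n ∈ suc j ℕ.≤ n ] Σ[ ip≤n ∈ suc j + p ℕ.≤ n ]
      (at A (j + p) ip≤n <ₒ at A j i≤n)

{-# OPTIONS --safe #-}
module Submission where

open import Defs
open import Level using (Level)
open import Data.Nat as ℕ using (ℕ; suc; _+_; s≤s; z≤n)
open import Data.Nat.Properties using (≤-trans; ≤-reflexive; +-assoc; +-monoʳ-≤; ≤-irrelevant)
open import Data.Fin using (Fin; fromℕ<)
open import Data.Product using (_×_; _,_)
open import Relation.Nullary using (¬_)
open import Relation.Binary.Bundles using (Poset; TotalOrder)
import Relation.Binary.Properties.Poset as PosetProperties
open import Relation.Binary.PropositionalEquality using (_≡_; refl; cong; sym; subst₂)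
import Relation.Binary.Construct.NonStrictToStrict as ToStrict

-- Write a, b, c, d for A(i), …, A(i+3).  2-sortedness gives a ≤ c and b ≤ d, so
-- d < a forces b ≤ d < a ≤ c: hence b < a and d < c, while c < b would close
-- the cycle a ≤ c < b ≤ d < a.

module _ {c ℓ₁ ℓ₂ : Level} (P : Poset c ℓ₁ ℓ₂) where
  open Poset P
  open PosetProperties P using (_<_; <-asym)

  private
    <-≤-trans : ∀ {x y z} → x < y → y ≤ z → x < z
    <-≤-trans = ToStrict.<-≤-trans _≈_ _≤_ Eq.sym trans antisym ≤-respʳ-≈

    ≤-<-trans : ∀ {x y z} → x ≤ y → y < z → x < z
    ≤-<-trans = ToStrict.≤-<-trans _≈_ _≤_ trans antisym ≤-respˡ-≈

  crossing-inversion : ∀ {a b c d} → a ≤ c → b ≤ d → d < a →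
                       b < a × d < c × ¬ (c < b)
  crossing-inversion a≤c b≤d d<a =
      ≤-<-trans b≤d d<a
    , <-≤-trans d<a a≤c
    , λ c<b → <-asym d<a (≤-<-trans a≤c (<-≤-trans c<b b≤d))

lookup-fromℕ<-cong : ∀ {a} {X : Set a} {n} (A : Fin n → X) {k k′}
                     (p : suc k ℕ.≤ n) (p′ : suc k′ ℕ.≤ n) →
                     k ≡ k′ → A (fromℕ< p) ≡ A (fromℕ< p′)
lookup-fromℕ<-cong A p p′ refl = cong (λ q → A (fromℕ< q)) (≤-irrelevant p p′)

lemma6 : {c ℓ₁ ℓ₂ : Level} (O : TotalOrder c ℓ₁ ℓ₂) (n : ℕ)
         (A : Fin n → TotalOrder.Carrier O) (j : ℕ) →
         Sorted O 2 n A →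
         Inversion O 3 n A j →
         Inversion O 1 n A j × Inversion O 1 n A (j + 2) × ¬ Inversion O 1 n A (j + 1)
lemma6 O n A j sorted (_ , i≤n , i+3≤n , d<a) =
  let (b<a , d<c , ¬c<b) = crossing in
    (s≤s z≤n , i≤n , i+1≤n , b<a)
  , (s≤s z≤n , i+2≤n , i+2+1≤n ,
     subst₂ _<_ (lookup-fromℕ<-cong A i+3≤n i+2+1≤n (sym (+-assoc j 2 1))) refl d<c)
  , λ (_ , i+1≤n′ , i+1+1≤n , c<b) → ¬c<b
      (subst₂ _<_ (lookup-fromℕ<-cong A i+1+1≤n i+2≤n (+-assoc j 1 1))
                  (lookup-fromℕ<-cong A i+1≤n′ i+1≤n refl) c<b)
  where
    open TotalOrder O using (_≤_)
    _<_ : TotalOrder.Carrier O → TotalOrder.Carrier O → Set _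
    _<_ = _<ₒ_ O

    below-i+3 : ∀ m → m ℕ.≤ j + 3 → suc m ℕ.≤ n
    below-i+3 m m≤j+3 = ≤-trans (s≤s m≤j+3) i+3≤n

    i+1≤n : suc (j + 1) ℕ.≤ n
    i+2≤n : suc (j + 2) ℕ.≤ n
    i+2+1≤n : suc (j + 2 + 1) ℕ.≤ n
    i+1+2≤n : suc (j + 1 + 2) ℕ.≤ n
    i+1≤n = below-i+3 (j + 1) (+-monoʳ-≤ j (s≤s z≤n))
    i+2≤n = below-i+3 (j + 2) (+-monoʳ-≤ j (s≤s (s≤s z≤n)))
    i+2+1≤n = below-i+3 (j + 2 + 1) (≤-reflexive (+-assoc j 2 1))
    i+1+2≤n = below-i+3 (j + 1 + 2) (≤-reflexive (+-assoc j 1 2))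

    a≤c : at O A j i≤n ≤ at O A (j + 2) i+2≤n
    a≤c = sorted j i≤n i+2≤n

    b≤d : at O A (j + 1) i+1≤n ≤ at O A (j + 3) i+3≤n
    b≤d = subst₂ _≤_ refl (lookup-fromℕ<-cong A i+1+2≤n i+3≤n (+-assoc j 1 2))
                          (sorted (j + 1) i+1≤n i+1+2≤n)

    crossing : at O A (j + 1) i+1≤n < at O A j i≤n
             × at O A (j + 3) i+3≤n < at O A (j + 2) i+2≤n
             × ¬ (at O A (j + 2) i+2≤n < at O A (j + 1) i+1≤n)
    crossing = crossing-inversion (TotalOrder.poset O) a≤c b≤d d<a
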